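{- Let $\mathcal{A}$ be a set of objects, each with a size $|A|\in\mathbb{N}$, let $B$ be a positive integer, let $\Phi,\Phi_2$ be sets, and let $f\colon\mathcal{A}\to\Phi$ be a function such that $|A|$ is determined by $f(A)$. Suppose there is a map $\mathrm{Decompose}$ assigning to each $A\in\mathcal{A}$ a tuple $\mathrm{Decompose}(A)=(\beta,A_1,\ldots,A_B)\in\Phi_2\times\mathcal{A}^B$; write $g(A)=\beta$ and $f_i(A)=f(A_i)$, and let $\mathcal{F}=\{(g(A),f_1(A),\ldots,f_B(A)) : A\in\mathcal{A}\}$. Assume: (P1) there is a function $\mathrm{Join}\colon\Phi_2\times\mathcal{A}^B\to\mathcal{A}$ with $\mathrm{Join}(\mathrm{Decompose}(A))=A$ for all $A\in\mathcal{A}$; (P2) $\mathrm{Decompose}(\mathrm{Join}(\beta,A_1,\ldots,A_B))=(\beta,A_1,\ldots,A_B)$ for all $A_1,\ldots,A_B\in\mathcal{A}$ and $\beta\in\Phi_2$ with $(\beta,f(A_1),\ldots,f(A_B))\in\mathcal{F}$; (P3) there is a function $f'\colon\mathcal{F}\to\Phi$ with $f(A)=f'(g(A),f_1(A),\ldots,f_B(A))$ for all $A\in\mathcal{A}$; (P4) there is a constant $\delta\le B/2$ such that if $\mathrm{Decompose}(A)=(\beta,A_1,\ldots,A_B)$ then $|A_i|\le\delta|A|/B$ for all $i$. For $\alpha\in\Phi$, $\beta\in\Phi_2$ let $N(\alpha,\beta)$ be the number of $A\in\mathcal{A}$ with $f(A)=\alpha$ and $g(A)=\beta$ (assumed finite),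 and let $\mathcal{X}_{\alpha,\beta}=\{(\vec{\alpha},\vec{\beta}) : \vec{\alpha}=(\alpha_1,\ldots,\alpha_B)\in\Phi^B,\ \vec{\beta}=(\beta_1,\ldots,\beta_B)\in\Phi_2^B,\ (\beta,\alpha_1,\ldots,\alpha_B)\in\mathcal{F},\ f'(\beta,\alpha_1,\ldots,\alpha_B)=\alpha\}$. Then for every $\alpha\in\Phi$ and $\beta\in\Phi_2$, $$\sum_{((\alpha_1,\ldots,\alpha_B),(\beta_1,\ldots,\beta_B))\in\mathcal{X}_{\alpha,\beta}}\ \prod_{i=1}^B N(\alpha_i,\beta_i)=N(\alpha,\beta).$$
   Context: This is the abstract setting of a "generalized aB-tree": objects (e.g. ordered trees) are recursively decomposed into $B$ sub-objects (some possibly of size $0$) together with a piece of reconstruction information $\beta\in\Phi_2$. -}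

module Defs where

open import Data.Nat using (ℕ; _*_; NonZero)
open import Data.Integer using (+_)
open import Data.Rational as ℚ using (ℚ; _/_)
open import Data.Product using (Σ; _×_; _,_; proj₁; proj₂)
open import Data.Vec as Vec using (Vec; foldr)
open import Relation.Binary.PropositionalEquality using (_≡_)

prodV : ∀ {n} → Vec ℕ n → ℕ
prodV = foldr _ _*_ 1

toℚ : ℕ → ℚ
toℚ n = (+ n) / 1

-- membership of (β, α₁, …, α_B) in 𝓕 = { (g(A), f(A₁), …, f(A_B)) : A ∈ 𝒜 },
-- where Decompose(A) = (g(A), A₁, …, A_B)
InF : {𝒜 Φ Φ₂ : Set} {B : ℕ} (f : 𝒜 → Φ) (decompose : 𝒜 → Φ₂ × Vec 𝒜 B) →
      Φ₂ → Vec Φ B → Set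
InF {𝒜} f decompose β αs =
  Σ 𝒜 (λ A → proj₁ (decompose A) ≡ β × Vec.map f (proj₂ (decompose A)) ≡ αs)

-- membership of (α⃗, β⃗) in 𝒳_{α,β}; f' is a function on 𝓕 (takes a membership proof)
InX : {𝒜 Φ Φ₂ : Set} {B : ℕ} (f : 𝒜 → Φ) (decompose : 𝒜 → Φ₂ × Vec 𝒜 B) →
      (f' : (β : Φ₂) (αs : Vec Φ B) → InF f decompose β αs → Φ) →
      Φ → Φ₂ → Vec Φ B × Vec Φ₂ B → Set
InX f decompose f' α β (αs , βs) =
  Σ (InF f decompose β αs) (λ p → f' β αs p ≡ α)

module Submission where

-- Call the "type" of an object A the pair of vectors (f(Aᵢ))ᵢ and (g(Aᵢ))ᵢ
-- formed from its parts Decompose(A) = (g(A), A₁, …, A_B).  The proof is a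
-- chain of explicit bijections whose cardinalities are the two sides:
--   * a product ∏ N(αᵢ, βᵢ) counts the vectors of objects of the prescribed
--     type (prod-↔), and a sum over a list counts pairs (entry, witness)
--     (sum-↔); hence the left-hand side counts pairs (x ∈ L, vector of type x);
--   * for a type x ∈ 𝒳_{α,β}, Decompose and Join are mutually inverse between
--     the objects counted by N(α, β) of type x and the vectors of type x
--     (type-fibre-↔); this uses (P1), (P2), (P3);
--   * every object counted by N(α, β) has a type in L, because its type lies in
--     𝒳_{α,β} and has a nonzero product, and L lists such types exactly once;
--     so these objects are partitioned by their type (partition-↔).
-- Composing, Fin (left-hand side) ↔ Fin (N α β), whence the equality.

open import Defs
open import Data.Nat using (ℕ; NonZero; ≢-nonZero⁻¹)
open import Data.Integer using (+_)
open import Data.Rational as ℚ using (ℚ; _/_; _≤_; _*_)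
open import Data.Fin using (Fin)
open import Data.Fin.Properties using (+↔⊎; *↔×; 0↔⊥; 1↔⊤; nonZeroIndex)
open import Data.Fin.Permutation using (↔⇒≡)
open import Data.Product using (Σ; _×_; _,_; proj₁; proj₂)
open import Data.Product.Function.NonDependent.Propositional using (_×-↔_)
open import Data.Sum using (_⊎_; inj₁; inj₂)
open import Data.Sum.Function.Propositional using (_⊎-↔_)
open import Data.Unit using (tt)
open import Data.Empty using (⊥-elim)
open import Data.Vec as Vec using (Vec; []; _∷_; lookup; zipWith)
open import Data.Vec.Properties using (∷-injectiveˡ; ∷-injectiveʳ)
open import Data.List using (List; []; _∷_; map)
open import Data.Nat.ListAction using (sum)
open import Data.List.Relation.Unary.All as All using (All)
open import Data.List.Relation.Unary.Any using (here; there)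
open import Data.List.Relation.Unary.Unique.Propositional using (Unique)
open import Data.List.Membership.Propositional using (_∈_)
open import Data.List.Membership.Setoid.Properties using (unique⇒irrelevant)
open import Function using (_∘_)
open import Function.Bundles using (_↔_; Inverse; mk↔ₛ′)
open import Function.Properties.Inverse using (↔-trans)
import Function.Related.Propositional as Related
open import Relation.Nullary.Irrelevant using (Irrelevant)
open import Relation.Binary.PropositionalEquality
  using (_≡_; _≢_; refl; sym; trans; cong; cong₂; subst; setoid; module ≡-Reasoning)
open import Relation.Binary.PropositionalEquality.WithK using (≡-irrelevant)

×-≡-irrelevant : {X Y : Set} {x x′ : X} {y y′ : Y} → Irrelevant ((x ≡ x′) × (y ≡ y′))
×-≡-irrelevant (p , q) (p′ , q′) = cong₂ _,_ (≡-irrelevant p p′) (≡-irrelevant q q′)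

Σ-≡-irrelevant : {X : Set} {P : X → Set} → (∀ {x} → Irrelevant (P x)) →
                 {x x′ : X} {p : P x} {p′ : P x′} → x ≡ x′ → (x , p) ≡ (x′ , p′)
Σ-≡-irrelevant P-irr {p = p} {p′} refl = cong (_ ,_) (P-irr p p′)

fibre : {Y X : Set} → (Y → X) → X → Set
fibre {Y} p x = Σ Y (λ y → p y ≡ x)

sum-↔ : {X : Set} (h : X → ℕ) (T : X → Set) → (∀ x → Fin (h x) ↔ T x) →
        (L : List X) → Fin (sum (map h L)) ↔ Σ X (λ x → x ∈ L × T x)
sum-↔ h T count [] =
  ↔-trans 0↔⊥ (mk↔ₛ′ ⊥-elim (λ { (_ , () , _) }) (λ { (_ , () , _) }) (λ ()))
sum-↔ {X} h T count (x ∷ L) =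
  ↔-trans +↔⊎ (↔-trans (count x ⊎-↔ sum-↔ h T count L) head-or-tail)
  where
  head-or-tail : (T x ⊎ Σ X (λ y → y ∈ L × T y)) ↔ Σ X (λ y → y ∈ x ∷ L × T y)
  head-or-tail = mk↔ₛ′
    (λ { (inj₁ t) → x , here refl , t ; (inj₂ (y , m , t)) → y , there m , t })
    (λ { (_ , here refl , t) → inj₁ t ; (y , there m , t) → inj₂ (y , m , t) })
    (λ { (_ , here refl , t) → refl ; (_ , there _ , _) → refl })
    (λ { (inj₁ _) → refl ; (inj₂ _) → refl })

partition-↔ : {Y X : Set} (p : Y → X) (L : List X) → Unique L → (∀ y → p y ∈ L) →
              Y ↔ Σ X (λ x → x ∈ L × fibre p x)
partition-↔ {Y} {X} p L unique covers = mk↔ₛ′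
  (λ y → p y , covers y , y , refl)
  (λ (_ , _ , y , _) → y)
  (λ { (_ , m , y , refl) →
         cong (λ m′ → p y , m′ , y , refl) (∈-irrelevant (covers y) m) })
  (λ _ → refl)
  where
  ∈-irrelevant : ∀ {x} → Irrelevant (x ∈ L)
  ∈-irrelevant = unique⇒irrelevant (setoid X) ≡-irrelevant unique

members-↔ : {X : Set} {T U : X → Set} (L : List X) → (∀ {x} → x ∈ L → T x ↔ U x) →
            Σ X (λ x → x ∈ L × T x) ↔ Σ X (λ x → x ∈ L × U x)
members-↔ L e = mk↔ₛ′
  (λ (x , m , t) → x , m , Inverse.to (e m) t)
  (λ (x , m , u) → x , m , Inverse.from (e m) u)
  (λ (x , m , u) → cong (λ u′ → x , m , u′) (Inverse.strictlyInverseˡ (e m) u))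
  (λ (x , m , t) → cong (λ t′ → x , m , t′) (Inverse.strictlyInverseʳ (e m) t))

module TypedVectors {E Φ Φ₂ : Set} (f : E → Φ) (g : E → Φ₂) (N : Φ → Φ₂ → ℕ)
  (count : ∀ a b → Fin (N a b) ↔ Σ E (λ e → f e ≡ a × g e ≡ b)) where

  Typed : ∀ {n} → Vec Φ n → Vec Φ₂ n → Set
  Typed {n} as bs = Σ (Vec E n) (λ es → Vec.map f es ≡ as × Vec.map g es ≡ bs)

  Typed-≡ : ∀ {n} {as : Vec Φ n} {bs : Vec Φ₂ n} {u v : Typed as bs} →
            proj₁ u ≡ proj₁ v → u ≡ v
  Typed-≡ = Σ-≡-irrelevant ×-≡-irrelevant

  ∷-↔ : ∀ {n a b} {as : Vec Φ n} {bs : Vec Φ₂ n} →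
        (Σ E (λ e → f e ≡ a × g e ≡ b) × Typed as bs) ↔ Typed (a ∷ as) (b ∷ bs)
  ∷-↔ = mk↔ₛ′
    (λ ((e , p , q) , (es , ps , qs)) → e ∷ es , cong₂ _∷_ p ps , cong₂ _∷_ q qs)
    (λ { (e ∷ es , ps , qs) → (e , ∷-injectiveˡ ps , ∷-injectiveˡ qs)
                             , (es , ∷-injectiveʳ ps , ∷-injectiveʳ qs) })
    (λ { (_ ∷ _ , _ , _) → Typed-≡ refl })
    (λ _ → cong₂ _,_ (Σ-≡-irrelevant ×-≡-irrelevant refl) (Typed-≡ refl))

  prod-↔ : ∀ {n} (as : Vec Φ n) (bs : Vec Φ₂ n) → Fin (prodV (zipWith N as bs)) ↔ Typed as bs
  prod-↔ [] [] =
    ↔-trans 1↔⊤ (mk↔ₛ′ (λ _ → [] , refl , refl) (λ _ → tt) (λ { ([] , _ , _) → Typed-≡ refl }) (λ _ → refl))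
  prod-↔ (a ∷ as) (b ∷ bs) = ↔-trans *↔× (↔-trans (count a b ×-↔ prod-↔ as bs) ∷-↔)

  prod≢0 : ∀ {n} {as : Vec Φ n} {bs : Vec Φ₂ n} → Typed as bs → prodV (zipWith N as bs) ≢ 0
  prod≢0 {as = as} {bs} v = ≢-nonZero⁻¹ _ {{nonZeroIndex (Inverse.from (prod-↔ as bs) v)}}

module Decomposition {𝒜 Φ Φ₂ : Set} (B : ℕ) (f : 𝒜 → Φ) (decompose : 𝒜 → Φ₂ × Vec 𝒜 B)
  (join : Φ₂ × Vec 𝒜 B → 𝒜)
  (join-decompose : ∀ A → join (decompose A) ≡ A)
  (decompose-join : ∀ β As → InF f decompose β (Vec.map f As) → decompose (join (β , As)) ≡ (β , As))
  (f' : (β : Φ₂) (αs : Vec Φ B) → InF f decompose β αs → Φ)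
  (f'-irrelevant : ∀ β αs p q → f' β αs p ≡ f' β αs q)
  (f≡f' : ∀ A → f A ≡ f' (proj₁ (decompose A)) (Vec.map f (proj₂ (decompose A))) (A , refl , refl))
  (N : Φ → Φ₂ → ℕ)
  (count : ∀ α β → Fin (N α β) ↔ Σ 𝒜 (λ A → f A ≡ α × proj₁ (decompose A) ≡ β))
  where

  g : 𝒜 → Φ₂
  g A = proj₁ (decompose A)

  parts : 𝒜 → Vec 𝒜 B
  parts A = proj₂ (decompose A)

  type : 𝒜 → Vec Φ B × Vec Φ₂ B
  type A = Vec.map f (parts A) , Vec.map g (parts A)

  Counted : Φ → Φ₂ → Set
  Counted α β = Σ 𝒜 (λ A → f A ≡ α × g A ≡ β)

  open TypedVectors f g N count using (Typed; Typed-≡; prod-↔; prod≢0)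

  f'-cong : ∀ {β β′ αs αs′} (p : InF f decompose β αs) (p′ : InF f decompose β′ αs′) →
            β ≡ β′ → αs ≡ αs′ → f' β αs p ≡ f' β′ αs′ p′
  f'-cong p p′ refl refl = f'-irrelevant _ _ p p′

  join-parts : ∀ {A β} → g A ≡ β → join (β , parts A) ≡ A
  join-parts {A} refl = join-decompose A

  type∈𝒳 : ∀ {α β} ((A , _) : Counted α β) → InX f decompose f' α β (type A)
  type∈𝒳 {α} (A , fA≡α , gA≡β) = witness , (begin
      f' _ _ witness
    ≡⟨ f'-cong witness (A , refl , refl) (sym gA≡β) refl ⟩
      f' (g A) (Vec.map f (parts A)) (A , refl , refl)
    ≡⟨ sym (f≡f' A) ⟩
      f A
    ≡⟨ fA≡α ⟩
      α ∎)
    where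
    open ≡-Reasoning
    witness : InF f decompose _ (Vec.map f (parts A))
    witness = A , gA≡β , refl

  type-fibre-↔ : ∀ {α β αs βs} → InX f decompose f' α β (αs , βs) →
                 fibre {Counted α β} (type ∘ proj₁) (αs , βs) ↔ Typed αs βs
  type-fibre-↔ {α} {β} {αs} {βs} (x∈𝓕 , f'≡α) = mk↔ₛ′ to from
    (λ (As , fAs≡αs , _) → Typed-≡ (cong proj₂ (decompose-join′ As fAs≡αs)))
    (λ ((A , _ , gA≡β) , _) →
       Σ-≡-irrelevant ≡-irrelevant (Σ-≡-irrelevant ×-≡-irrelevant (join-parts gA≡β)))
    where
    open ≡-Reasoning

    decompose-join′ : ∀ As → Vec.map f As ≡ αs → decompose (join (β , As)) ≡ (β , As)
    decompose-join′ As fAs≡αs =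
      decompose-join β As (subst (InF f decompose β) (sym fAs≡αs) x∈𝓕)

    f-join : ∀ As → Vec.map f As ≡ αs → f (join (β , As)) ≡ α
    f-join As fAs≡αs = begin
        f J
      ≡⟨ f≡f' J ⟩
        f' (g J) (Vec.map f (parts J)) (J , refl , refl)
      ≡⟨ f'-cong _ x∈𝓕 (cong proj₁ d) (trans (cong (Vec.map f ∘ proj₂) d) fAs≡αs) ⟩
        f' β αs x∈𝓕
      ≡⟨ f'≡α ⟩
        α ∎
      where
      J = join (β , As)
      d = decompose-join′ As fAs≡αs

    to : fibre (type ∘ proj₁) (αs , βs) → Typed αs βs
    to ((A , _ , _) , typeA≡x) = parts A , cong proj₁ typeA≡x , cong proj₂ typeA≡x

    from : Typed αs βs → fibre (type ∘ proj₁) (αs , βs)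
    from (As , fAs≡αs , gAs≡βs) =
      (join (β , As) , f-join As fAs≡αs , cong proj₁ d) ,
      trans (cong (λ D → Vec.map f (proj₂ D) , Vec.map g (proj₂ D)) d) (cong₂ _,_ fAs≡αs gAs≡βs)
      where
      d = decompose-join′ As fAs≡αs

  module _ (α : Φ) (β : Φ₂) (L : List (Vec Φ B × Vec Φ₂ B))
    (L⊆𝒳 : All (InX f decompose f' α β) L) (unique : Unique L)
    (covers : ∀ x → InX f decompose f' α β x → prodV (zipWith N (proj₁ x) (proj₂ x)) ≢ 0 → x ∈ L)
    where

    type∈L : (A : Counted α β) → type (proj₁ A) ∈ L
    type∈L A = covers _ (type∈𝒳 A) (prod≢0 (parts (proj₁ A) , refl , refl))

    count-↔ : Fin (sum (map (λ x → prodV (zipWith N (proj₁ x) (proj₂ x))) L)) ↔ Fin (N α β)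
    count-↔ = begin
      Fin (sum (map (λ x → prodV (zipWith N (proj₁ x) (proj₂ x))) L))
        ↔⟨ sum-↔ _ (λ x → Typed (proj₁ x) (proj₂ x)) (λ x → prod-↔ (proj₁ x) (proj₂ x)) L ⟩
      Σ _ (λ x → x ∈ L × Typed (proj₁ x) (proj₂ x))
        ↔⟨ members-↔ L (λ m → type-fibre-↔ (All.lookup L⊆𝒳 m)) ⟨
      Σ _ (λ x → x ∈ L × fibre (type ∘ proj₁) x)
        ↔⟨ partition-↔ (type ∘ proj₁) L unique type∈L ⟨
      Counted α β
        ↔⟨ count α β ⟨
      Fin (N α β) ∎
      where open Related.EquationalReasoning

lemma2 : (𝒜 Φ Φ₂ : Set) (size : 𝒜 → ℕ) (B : ℕ) {{_ : NonZero B}}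
    (f : 𝒜 → Φ)
    → (∀ A A′ → f A ≡ f A′ → size A ≡ size A′)
    → (decompose : 𝒜 → Φ₂ × Vec 𝒜 B)
    → (join : Φ₂ × Vec 𝒜 B → 𝒜)
    → (∀ A → join (decompose A) ≡ A)
    → (∀ β As → InF f decompose β (Vec.map f As) → decompose (join (β , As)) ≡ (β , As))
    → (f' : (β : Φ₂) (αs : Vec Φ B) → InF f decompose β αs → Φ)
    → (∀ β αs p q → f' β αs p ≡ f' β αs q)
    → (∀ A → f A ≡ f' (proj₁ (decompose A)) (Vec.map f (proj₂ (decompose A))) (A , _≡_.refl , _≡_.refl))
    → (δ : ℚ) → δ ≤ (+ B) / 2
    → (∀ A (i : Fin B) → toℚ (size (lookup (proj₂ (decompose A)) i)) ≤ (δ * toℚ (size A)) * ((+ 1) / B))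
    → (N : Φ → Φ₂ → ℕ)
    → (∀ α β → Fin (N α β) ↔ Σ 𝒜 (λ A → f A ≡ α × proj₁ (decompose A) ≡ β))
    → ∀ α β
    → (L : List (Vec Φ B × Vec Φ₂ B))
    → All (InX f decompose f' α β) L
    → Unique L
    → (∀ x → InX f decompose f' α β x → prodV (zipWith N (proj₁ x) (proj₂ x)) ≢ 0 → x ∈ L)
    → sum (map (λ x → prodV (zipWith N (proj₁ x) (proj₂ x))) L) ≡ N α β
lemma2 𝒜 Φ Φ₂ size B f _ decompose join P1 P2 f' f'-irrelevant P3 δ _ _ N count α β L L⊆𝒳 unique covers =
  ↔⇒≡ (Decomposition.count-↔ B f decompose join P1 P2 f' f'-irrelevant P3 N count α β L L⊆𝒳 unique covers)
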